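{- Let $\mathbf{P}$ be an integral meet-semilattice monoid and let $D\subseteq P$ be a nonempty set such that $a\backslash_{\mathcal{L}(\mathbf{P})} b$, $b/_{\mathcal{L}(\mathbf{P})} a$ and $a\to_{\mathcal{L}(\mathbf{P})} b$ all belong to $D$ for all $a\in P$ and $b\in D$. Then the closure system $\overline{D}=\{\bigcap X\mid X\subseteq D\}$ (with $\bigcap\emptyset=P$) of $\mathcal{L}(\mathbf{P})$ generated by $D$ is a nucleus-system of both $\langle\mathcal{L}(\mathbf{P}),\cap,\cup,\circ,\backslash_{\mathcal{L}(\mathbf{P})},/_{\mathcal{L}(\mathbf{P})},P\rangle$ and $\langle\mathcal{L}(\mathbf{P}),\cap,\cup,\cap,\to_{\mathcal{L}(\mathbf{P})},P\rangle$. Equivalently, the associated closure operator $\gamma_{\overline{D}}$, $\gamma_{\overline{D}}(a)=\bigcap\{d\in D\mid a\subseteq d\}$, is a nucleus on both of these algebras.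
   Context: An integral meet-semilattice monoid is a partially ordered monoid (multiplication order-preserving in each argument) whose order is a meet-semilattice and whose unit $1$ is the greatest element. $\mathcal{L}(\mathbf{P})$ is the set of order-ideals (down-sets) of $\mathbf{P}$ ordered by inclusion, $p\in P$ identified with ${\downarrow}p$; it carries product $X\circ Y={\downarrow}\{xy\mid x\in X,y\in Y\}$, residuals $X\backslash Y=\{z\mid xz\in Y\ \forall x\in X\}$, $Y/X=\{z\mid zx\in Y\ \forall x\in X\}$, and Heyting implication $X\to Y=\{z\in P\mid{\downarrow}z\cap X\subseteq Y\}$. A nucleus with respect to a multiplication $*$ is a closure operator $\gamma$ with $\gamma(a)*\gamma(b)\le\gamma(a*b)$; a nucleus-system is a closure system $C$ (i.e. $\min\{c\in C\mid x\le c\}$ exists for all $x$) such that the residuals ($x\backslash a$, $a/x$, resp. $x\to a$) of elements $a\in C$ by arbitrary $x$ lie in $C$. -}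

module Defs where

open import Level using (Level; suc; _⊔_)
open import Data.Product using (Σ; _×_; _,_; ∃)
open import Relation.Binary.Lattice using (MeetSemilattice)
open import Algebra.Structures using (IsMonoid)
open import Algebra.Core using (Op₂)

-- All components live in one universe level a (down-sets are Set a-valued predicates).
record IMSMonoid (a : Level) : Set (suc a) where
  field
    meetSemilattice : MeetSemilattice a a a
  open MeetSemilattice meetSemilattice public
  field
    _·_      : Op₂ Carrier
    one      : Carrier
    isMonoid : IsMonoid _≈_ _·_ one
    ·-mono   : ∀ {x y u v} → x ≤ y → u ≤ v → (x · u) ≤ (y · v)
    integral : ∀ x → x ≤ one

module LP {a : Level} (P : IMSMonoid a) where
  open IMSMonoid P

  Subset : Set (suc a)
  Subset = Carrier → Set a

  record DownSet : Set (suc a) where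
    field
      mem       : Subset
      downClose : ∀ {x y} → x ≤ y → mem y → mem x
  open DownSet public

  _⊆_ : DownSet → DownSet → Set a
  X ⊆ Y = ∀ z → mem X z → mem Y z

  _≐_ : DownSet → DownSet → Set a
  X ≐ Y = (X ⊆ Y) × (Y ⊆ X)

  -- p ∈ P identified with ↓p
  ↓ : Carrier → DownSet
  ↓ p = record { mem = λ z → z ≤ p ; downClose = λ x≤y y≤p → trans x≤y y≤p }

  _\\_ : DownSet → DownSet → DownSet
  X \\ Y = record
    { mem = λ z → ∀ x → mem X x → mem Y (x · z)
    ; downClose = λ z'≤z h x x∈X → downClose Y (·-mono refl z'≤z) (h x x∈X) }

  _//_ : DownSet → DownSet → DownSet
  Y // X = record
    { mem = λ z → ∀ x → mem X x → mem Y (z · x)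
    ; downClose = λ z'≤z h x x∈X → downClose Y (·-mono z'≤z refl) (h x x∈X) }

  _⇒_ : DownSet → DownSet → DownSet
  X ⇒ Y = record
    { mem = λ z → ∀ w → w ≤ z → mem X w → mem Y w
    ; downClose = λ z'≤z h w w≤z' w∈X → h w (trans w≤z' z'≤z) w∈X }

  -- intersection of a family of principal down-sets indexed by X ⊆ P
  -- (⋂ ∅ = P)
  ⋂ : Subset → DownSet
  ⋂ X = record
    { mem = λ z → ∀ d → X d → z ≤ d
    ; downClose = λ x≤y h d d∈X → trans x≤y (h d d∈X) }

  Closure : Subset → DownSet → Set (suc a)
  Closure D S = Σ Subset λ X → (∀ d → X d → D d) × (S ≐ ⋂ X)

  IsClosureSystem : (DownSet → Set (suc a)) → Set (suc a)
  IsClosureSystem C = ∀ (S : DownSet) →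
    Σ DownSet λ c → C c × (S ⊆ c) × (∀ c' → C c' → S ⊆ c' → c ⊆ c')

  IsResidNucleusSystem : (DownSet → Set (suc a)) → Set (suc a)
  IsResidNucleusSystem C = IsClosureSystem C ×
    (∀ (X A : DownSet) → C A → C (X \\ A) × C (A // X))

  IsHeytingNucleusSystem : (DownSet → Set (suc a)) → Set (suc a)
  IsHeytingNucleusSystem C = IsClosureSystem C ×
    (∀ (X A : DownSet) → C A → C (X ⇒ A))

-- Every down-set A ∈ D̄ is ⋂ Y for some Y ⊆ D, and each of the three residuals
-- X ⊙ (⋂ Y) is the intersection of the principal residuals ↓x ⊙ ↓b over x ∈ X, b ∈ Y
-- (residuals turn joins in one argument and meets in the other into meets, and
-- X = ⋃ {↓x | x ∈ X}). By hypothesis each ↓x ⊙ ↓b is some ↓d with d ∈ D, and D̄ is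
-- closed under arbitrary intersections, so X ⊙ A ∈ D̄.
module Submission where

open import Defs
open import Level using (Level)
open import Data.Product using (Σ; Σ-syntax; _×_; ∃; _,_; proj₁; proj₂)
open import Function using (flip)

module DownSetClosure {a : Level} (P : IMSMonoid a) where
  open IMSMonoid P
  open LP P

  ⋀ : {I : Set a} → (I → DownSet) → DownSet
  ⋀ F = record
    { mem       = λ z → ∀ i → mem (F i) z
    ; downClose = λ x≤y h i → downClose (F i) x≤y (h i) }

  PrincipalPair : DownSet → Subset → Set a
  PrincipalPair X Y = Σ[ x ∈ Carrier ] Σ[ b ∈ Carrier ] mem X x × Y b

  ↓-⊙ : (DownSet → DownSet → DownSet) → ∀ {X Y} → PrincipalPair X Y → DownSet
  ↓-⊙ _⊙_ (x , b , _) = ↓ x ⊙ ↓ b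

  ⋀-principal : (DownSet → DownSet → DownSet) → DownSet → Subset → DownSet
  ⋀-principal _⊙_ X Y = ⋀ (↓-⊙ _⊙_ {X} {Y})

  MeetDecomposable : (DownSet → DownSet → DownSet) → Set (Level.suc a)
  MeetDecomposable _⊙_ = ∀ X A Y → A ≐ ⋂ Y → (X ⊙ A) ≐ ⋀-principal _⊙_ X Y

  \\-meetDecomposable : MeetDecomposable _\\_
  \\-meetDecomposable X A Y (A⊆⋂Y , ⋂Y⊆A) = to , from
    where
    to : (X \\ A) ⊆ ⋀-principal _\\_ X Y
    to z z∈X\\A (x , b , x∈X , b∈Y) x' x'≤x =
      trans (·-mono x'≤x refl) (A⊆⋂Y _ (z∈X\\A x x∈X) b b∈Y)
    from : ⋀-principal _\\_ X Y ⊆ (X \\ A)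
    from z h x x∈X = ⋂Y⊆A _ λ b b∈Y → h (x , b , x∈X , b∈Y) x refl

  //-meetDecomposable : MeetDecomposable (flip _//_)
  //-meetDecomposable X A Y (A⊆⋂Y , ⋂Y⊆A) = to , from
    where
    to : (A // X) ⊆ ⋀-principal (flip _//_) X Y
    to z z∈A//X (x , b , x∈X , b∈Y) x' x'≤x =
      trans (·-mono refl x'≤x) (A⊆⋂Y _ (z∈A//X x x∈X) b b∈Y)
    from : ⋀-principal (flip _//_) X Y ⊆ (A // X)
    from z h x x∈X = ⋂Y⊆A _ λ b b∈Y → h (x , b , x∈X , b∈Y) x refl

  ⇒-meetDecomposable : MeetDecomposable _⇒_
  ⇒-meetDecomposable X A Y (A⊆⋂Y , ⋂Y⊆A) = to , from
    where
    to : (X ⇒ A) ⊆ ⋀-principal _⇒_ X Y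
    to z z∈X⇒A (x , b , x∈X , b∈Y) w w≤z w≤x =
      A⊆⋂Y w (z∈X⇒A w w≤z (downClose X w≤x x∈X)) b b∈Y
    from : ⋀-principal _⇒_ X Y ⊆ (X ⇒ A)
    from z h w w≤z w∈X = ⋂Y⊆A w λ b b∈Y → h (w , b , w∈X , b∈Y) w w≤z refl

  module Generated (D : Subset) where

    Closure-resp-≐ : ∀ {S T} → S ≐ T → Closure D T → Closure D S
    Closure-resp-≐ (S⊆T , T⊆S) (Y , Y⊆D , T⊆⋂Y , ⋂Y⊆T) =
      Y , Y⊆D , (λ z z∈S → T⊆⋂Y z (S⊆T z z∈S)) , (λ z z∈⋂Y → T⊆S z (⋂Y⊆T z z∈⋂Y))

    ↓-Closure : ∀ {d} → D d → Closure D (↓ d)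
    ↓-Closure {d} d∈D = (λ e → D e × d ≤ e) , (λ _ → proj₁) ,
      (λ z z≤d e (_ , d≤e) → trans z≤d d≤e) , (λ z h → h d (d∈D , refl))

    ⋀-Closure : {I : Set a} (F : I → DownSet) →
                (∀ i → Closure D (F i)) → Closure D (⋀ F)
    ⋀-Closure {I} F F∈D̄ = Y , Y⊆D , to , from
      where
      Y : Subset
      Y d = Σ I λ i → proj₁ (F∈D̄ i) d
      Y⊆D : ∀ d → Y d → D d
      Y⊆D d (i , d∈Yᵢ) = proj₁ (proj₂ (F∈D̄ i)) d d∈Yᵢ
      to : ⋀ F ⊆ ⋂ Y
      to z z∈⋀F d (i , d∈Yᵢ) = proj₁ (proj₂ (proj₂ (F∈D̄ i))) z (z∈⋀F i) d d∈Yᵢ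
      from : ⋂ Y ⊆ ⋀ F
      from z z∈⋂Y i = proj₂ (proj₂ (proj₂ (F∈D̄ i))) z λ d d∈Yᵢ → z∈⋂Y d (i , d∈Yᵢ)

    Closure-closed : (_⊙_ : DownSet → DownSet → DownSet) → MeetDecomposable _⊙_ →
      (∀ p b → D b → Σ Carrier λ d → D d × ((↓ p ⊙ ↓ b) ≐ ↓ d)) →
      ∀ X A → Closure D A → Closure D (X ⊙ A)
    Closure-closed _⊙_ decompose principal X A (Y , Y⊆D , A≐⋂Y) =
      Closure-resp-≐ {X ⊙ A} {⋀-principal _⊙_ X Y} (decompose X A Y A≐⋂Y)
        (⋀-Closure (↓-⊙ _⊙_ {X} {Y}) principal∈D̄)
      where
      principal∈D̄ : ((x , b , _) : PrincipalPair X Y) → Closure D (↓ x ⊙ ↓ b)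
      principal∈D̄ (x , b , _ , b∈Y) =
        let (d , d∈D , x⊙b≐d) = principal x b (Y⊆D b b∈Y)
        in Closure-resp-≐ {↓ x ⊙ ↓ b} {↓ d} x⊙b≐d (↓-Closure d∈D)

    γ : DownSet → DownSet
    γ S = ⋂ λ d → D d × (S ⊆ ↓ d)

    Closure-isClosureSystem : IsClosureSystem (Closure D)
    Closure-isClosureSystem S = γ S , γS∈D̄ , S⊆γS , γS-least
      where
      γS∈D̄ : Closure D (γ S)
      γS∈D̄ = (λ d → D d × (S ⊆ ↓ d)) , (λ _ → proj₁) , (λ _ h → h) , (λ _ h → h)
      S⊆γS : S ⊆ γ S
      S⊆γS z z∈S d (_ , S⊆d) = S⊆d z z∈S
      γS-least : ∀ C → Closure D C → S ⊆ C → γ S ⊆ C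
      γS-least C (Y , Y⊆D , C⊆⋂Y , ⋂Y⊆C) S⊆C z z∈γS = ⋂Y⊆C z λ d d∈Y →
        z∈γS d (Y⊆D d d∈Y , λ w w∈S → C⊆⋂Y w (S⊆C w w∈S) d d∈Y)

corollary5p11 : ∀ {a : Level} (P : IMSMonoid a) →
    let open IMSMonoid P
        open LP P
    in (D : Subset) →
       (∃ λ d → D d) →
       (∀ p b → D b → Σ Carrier λ d → D d × ((↓ p \\ ↓ b) ≐ ↓ d)) →
       (∀ p b → D b → Σ Carrier λ d → D d × ((↓ b // ↓ p) ≐ ↓ d)) →
       (∀ p b → D b → Σ Carrier λ d → D d × ((↓ p ⇒ ↓ b) ≐ ↓ d)) →
       IsResidNucleusSystem (Closure D) × IsHeytingNucleusSystem (Closure D)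
corollary5p11 P D _ \\-principal //-principal ⇒-principal =
  (Closure-isClosureSystem , λ X A A∈D̄ →
      Closure-closed _\\_ \\-meetDecomposable \\-principal X A A∈D̄ ,
      Closure-closed (flip _//_) //-meetDecomposable //-principal X A A∈D̄) ,
  (Closure-isClosureSystem , Closure-closed _⇒_ ⇒-meetDecomposable ⇒-principal)
  where
  open LP P
  open DownSetClosure P
  open Generated D
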